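{- Let $S_1$ be a primitive non-powerful signed digraph of order $n$ whose underlying digraph is $D_1$. Then for every integer $k$ with $1 \le k \le n$, $L(S_1,k) = (2n-k)(n-1)+1$.
   Context: A signed digraph $S$ is a digraph (loops allowed, no multiple arcs) on a finite vertex set in which each arc is assigned a sign $1$ or $-1$; its underlying digraph is obtained by forgetting the signs, and its order is its number of vertices. A walk of length $m$ is a sequence of arcs $e_1,\dots,e_m$ such that the terminal vertex of $e_i$ is the initial vertex of $e_{i+1}$; for each vertex $u$ there is also the trivial walk of length $0$ from $u$ to $u$. The sign of a walk is the product of the signs of its arcs (the trivial walk has sign $1$). Two walks form a pair of SSSD walks if they have the same initial vertex, the same terminal vertex, the same length, but different signs. A digraph $D$ is primitive if there is a positive integer $m$ such that for every ordered pair $(u,v)$ of vertices there is a walk of length $m$ from $u$ to $v$; a signed digraph is primitive if its underlying digraph is. A signed digraph is non-powerful if it contains a pair of SSSD walks. For a primitive non-powerful signed digraph $S$ and $X \subseteq V(S)$, $l_S(X)$ is the least integer $p\ge 0$ such that for every vertex $v$ of $S$ there exist $x\in X$ and a pair of SSSD walks of length $p$ from $x$ to $v$; the $k$th upper base is $L(S,k)=\max\{l_S(X) : X\subseteq V(S),\ |X|=k\}$. $D_1$ is the digraph with vertex set $\{1,\dots,n\}$ and arcs $(i,i+1)$ for $1\le i\le n-1$, $(n,1)$ and $(n-1,1)$. -}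

module Defs where

open import Data.Nat using (ℕ; zero; suc; _<_; _≤_)
open import Data.Fin using (Fin; toℕ)
open import Data.Fin.Subset using (Subset; _∈_; ∣_∣)
open import Data.Maybe using (Maybe; just; nothing)
open import Data.Product using (Σ; ∃; ∃-syntax; _×_; _,_)
open import Data.Sum using (_⊎_)
open import Relation.Nullary using (¬_)
open import Relation.Binary.PropositionalEquality using (_≡_; _≢_)

data Sign : Set where
  pos neg : Sign

_·_ : Sign → Sign → Sign
pos · s = s
neg · pos = neg
neg · neg = pos

-- A signed digraph on vertex set Fin n: arc u v = nothing means no arc
-- (u,v); arc u v = just s means an arc (u,v) of sign s.  Loops allowed,
-- no multiple arcs.
SignedDigraph : ℕ → Set
SignedDigraph n = Fin n → Fin n → Maybe Sign

Digraph : ℕ → Set₁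
Digraph n = Fin n → Fin n → Set

Underlying : ∀ {n} → SignedDigraph n → Digraph n
Underlying S u v = ∃[ s ] S u v ≡ just s

SameDigraph : ∀ {n} → Digraph n → Digraph n → Set
SameDigraph D E = ∀ u v → (D u v → E u v) × (E u v → D u v)

-- D_1 with vertices 1..n renamed to 0..n-1:
-- arcs (i,i+1) for 0 ≤ i ≤ n-2, (n-1,0) and (n-2,0).
D₁ : (n : ℕ) → Digraph n
D₁ n i j = (toℕ j ≡ suc (toℕ i))
         ⊎ (toℕ j ≡ 0 × (suc (toℕ i) ≡ n ⊎ suc (suc (toℕ i)) ≡ n))

data Walk {n} (D : Digraph n) : ℕ → Fin n → Fin n → Set where
  []  : ∀ {u} → Walk D 0 u u
  _∷_ : ∀ {m u w v} → D u w → Walk D m w v → Walk D (suc m) u v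

SWalk : ∀ {n} → SignedDigraph n → ℕ → Fin n → Fin n → Set
SWalk S = Walk (Underlying S)

sign : ∀ {n} {S : SignedDigraph n} {m u v} → SWalk S m u v → Sign
sign [] = pos
sign ((s , _) ∷ w) = s · sign w

SSSD : ∀ {n} → SignedDigraph n → ℕ → Fin n → Fin n → Set
SSSD S m u v = Σ (SWalk S m u v) λ w₁ → Σ (SWalk S m u v) λ w₂ → sign w₁ ≢ sign w₂

Primitive : ∀ {n} → Digraph n → Set
Primitive D = ∃[ m ] (1 ≤ m × (∀ u v → Walk D m u v))

PrimitiveS : ∀ {n} → SignedDigraph n → Set
PrimitiveS S = Primitive (Underlying S)

NonPowerful : ∀ {n} → SignedDigraph n → Set
NonPowerful S = ∃[ m ] ∃[ u ] ∃[ v ] SSSD S m u v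

SSSDBase : ∀ {n} → SignedDigraph n → Subset n → ℕ → Set
SSSDBase S X p = ∀ v → ∃[ x ] (x ∈ X × SSSD S p x v)

-- l_S(X) = p : p is the least such integer.
IsLocalBase : ∀ {n} → SignedDigraph n → Subset n → ℕ → Set
IsLocalBase S X p = SSSDBase S X p × (∀ q → q < p → ¬ SSSDBase S X q)

-- L(S,k) = N : N is the maximum of l_S(X) over |X| = k.
IsUpperBase : ∀ {n} → SignedDigraph n → ℕ → ℕ → Set
IsUpperBase {n} S k N =
  (∀ (X : Subset n) → ∣ X ∣ ≡ k → ∃[ p ] (IsLocalBase S X p × p ≤ N))
  × (∃[ X ] (∣ X ∣ ≡ k × IsLocalBase S X N))

-- Write m = n − 1.  Let π x be the product of the signs along the path 0 → 1 → ⋯ → x, and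
-- let α and β be the signs of the n-cycle and of the m-cycle closed by the arc n−2 → 0.
-- A walk of length L from x to v that uses the two closing arcs a and b times satisfies
-- L + x = v + a n + b m, and its sign is π x · π v · α^a · β^b.  As m and n are coprime,
-- two pairs (a, b) for the same length differ by a multiple of (m, −n); hence S is
-- non-powerful iff α^m ≠ β^n, and two walks of equal length with different signs exist
-- only when L + x − v = n m + a n + b m for some a, b.  Conversely every (a, b) with a ≥ 1,
-- or with b ≥ 1 and x < m, is realised, and the pairs (A + m, B), (A, B + n) give two walks
-- of equal length and different signs.  With d = n − k, pigeonholing the rotation
-- x ↦ x + 1 − v (mod n) on X yields, for every v, an x ∈ X joined to v by such a pair of
-- length (n + d) m + 1; from X = {d, …, n − 1} no pair of SSSD walks of length (n + d) m
-- reaches the vertex n − 1.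

module Submission where

open import Algebra.Bundles using (CommutativeMonoid)
open import Data.Empty using (⊥)
open import Data.Fin using (Fin; toℕ; fromℕ; inject₁) renaming (zero to fzero; suc to fsuc)
open import Data.Fin.Properties
  using (any?; all?; _≟_; toℕ-injective; toℕ<n; toℕ-fromℕ; toℕ-fromℕ<; toℕ-inject₁)
open import Data.Fin.Subset using (Subset; _∈_; _∉_; _-_; ⁅_⁆; ∣_∣; Nonempty; inside; outside)
open import Data.Fin.Subset.Properties using (_∈?_; p─⊥≡p; p─q⊆p; x∈p∧x≢y⇒x∈p-y)
open import Data.List using (_∷_; [])
open import Data.Maybe using (just; nothing)
open import Data.Maybe.Properties using (just-injective)
open import Data.Nat using (ℕ; zero; suc; _+_; _*_; _∸_; _%_; _/_; _≤_; _<_; _≤′_; ≤′-refl; ≤′-step;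
                             z≤n; s≤s; s≤s⁻¹; z<s; _≤?_; _<?_; NonZero)
open import Data.Nat.DivMod using (m≡m%n+[m/n]*n; m<n⇒m%n≡m; [m+kn]%n≡m%n; _mod_)
open import Data.Nat.Properties hiding (_≟_)
open import Data.Nat.Tactic.RingSolver using (solve)
open import Data.Product using (Σ; ∃; ∃₂; _×_; _,_; proj₁; proj₂; map; map₂)
import Data.Product as Product
open import Data.Sum using (_⊎_; inj₁; inj₂)
import Data.Sum as Sum
open import Function using (_∘_; _∘′_; case_of_)
open import Function.Definitions using (Injective)
open import Level using (0ℓ)
open import Relation.Binary.Definitions using (DecidableEquality)
open import Relation.Binary.PropositionalEquality
open import Relation.Binary.PropositionalEquality.Algebra using (isMagma)
open import Relation.Nullary using (¬_; Dec; yes; no; contradiction)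
open import Relation.Nullary.Decidable using (map′; _×-dec_)
open import Relation.Unary using (Decidable)

find-least : ∀ {P : ℕ → Set} → Decidable P → ∀ {N} → P N →
             ∃ λ p → (P p × (∀ q → q < p → ¬ P q)) × p ≤ N
find-least P? {zero} P0 = 0 , (P0 , λ _ ()) , z≤n
find-least P? {suc N} PN with P? 0
... | yes P0 = 0 , (P0 , λ _ ()) , z≤n
... | no ¬P0 =
  let p , (Pp , below) , p≤N = find-least (P? ∘ suc) PN
  in suc p , (Pp , λ { zero _ → ¬P0 ; (suc q) q<p → below q (s≤s⁻¹ q<p) }) , s≤s p≤N

laps-+ : ∀ n m a₁ b₁ a₂ b₂ → (a₁ * n + b₁ * m) + (a₂ * n + b₂ * m) ≡ (a₁ + a₂) * n + (b₁ + b₂) * m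
laps-+ n m a₁ b₁ a₂ b₂ = solve (n ∷ m ∷ a₁ ∷ b₁ ∷ a₂ ∷ b₂ ∷ [])

module _ {k} .{{_ : NonZero k}} where

  remainder-unique : ∀ q r {x y} → x < k → y < k → q * k + x ≡ r * k + y → x ≡ y
  remainder-unique q r {x} {y} x<k y<k eq = begin
    x                ≡⟨ sym (m<n⇒m%n≡m x<k) ⟩
    x % k            ≡⟨ sym ([m+kn]%n≡m%n x q k) ⟩
    (x + q * k) % k  ≡⟨ cong (_% k) (trans (+-comm x _) (trans eq (+-comm _ y))) ⟩
    (y + r * k) % k  ≡⟨ [m+kn]%n≡m%n y r k ⟩
    y % k            ≡⟨ m<n⇒m%n≡m y<k ⟩
    y                ∎
    where open ≡-Reasoning

  quotient-unique : ∀ q r {x y} → x < k → y < k → q * k + x ≡ r * k + y → q ≡ r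
  quotient-unique q r {x} x<k y<k eq = *-cancelʳ-≡ q r k (+-cancelʳ-≡ x _ _
    (trans eq (cong (r * k +_) (sym (remainder-unique q r x<k y<k eq)))))

  +-%-injective : ∀ {c x y} → x < k → y < k → (x + c) % k ≡ (y + c) % k → x ≡ y
  +-%-injective {c} {x} {y} x<k y<k eq = remainder-unique qy qx x<k y<k (+-cancelʳ-≡ c _ _ (begin
    (qy * k + x) + c          ≡⟨ +-assoc (qy * k) x c ⟩
    qy * k + (x + c)          ≡⟨ cong (qy * k +_) (m≡m%n+[m/n]*n (x + c) k) ⟩
    qy * k + (r + qx * k)     ≡⟨ swap (qy * k) (qx * k) r ⟩
    qx * k + (r + qy * k)     ≡⟨ cong (λ r → qx * k + (r + qy * k)) eq ⟩
    qx * k + ((y + c) % k + qy * k) ≡⟨ cong (qx * k +_) (sym (m≡m%n+[m/n]*n (y + c) k)) ⟩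
    qx * k + (y + c)          ≡⟨ sym (+-assoc (qx * k) y c) ⟩
    (qx * k + y) + c          ∎))
    where
      open ≡-Reasoning
      qx = (x + c) / k
      qy = (y + c) / k
      r = (x + c) % k
      swap : ∀ a b r → a + (r + b) ≡ b + (r + a)
      swap a b r = solve (a ∷ b ∷ r ∷ [])

  offset-decomposition : ∀ {x v} → v ≤ k → ∃ λ q → suc x + k ≡ v + ((x + suc (k ∸ v)) % k + q * k)
  offset-decomposition {x} {v} v≤k = (x + suc (k ∸ v)) / k , (begin
    suc x + k                  ≡⟨ cong (suc x +_) (sym (m+[n∸m]≡n v≤k)) ⟩
    suc x + (v + (k ∸ v))      ≡⟨ shuffle x v (k ∸ v) ⟩
    v + (x + suc (k ∸ v))      ≡⟨ cong (v +_) (m≡m%n+[m/n]*n (x + suc (k ∸ v)) k) ⟩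
    v + ((x + suc (k ∸ v)) % k + (x + suc (k ∸ v)) / k * k) ∎)
    where
      open ≡-Reasoning
      shuffle : ∀ x v c → suc x + (v + c) ≡ v + (x + suc c)
      shuffle x v c = solve (x ∷ v ∷ c ∷ [])

-- Here suc m stands for n; it is spelt out so that the ring solver can use n = m + 1.
module Representations (m : ℕ) .{{_ : NonZero m}} where

  consecutive-common-multiple : ∀ e f → f * m ≡ e * suc m → ∃ λ t → e ≡ t * m × f ≡ t * suc m
  consecutive-common-multiple e f eq with m≤n⇒∃[o]m+o≡n e≤f
    where
      e≤f : e ≤ f
      e≤f = *-cancelʳ-≤ e f m (subst (e * m ≤_) (sym eq) (*-monoʳ-≤ e (n≤1+n m)))
  ... | t , refl = t , sym tm≡e , (begin
    e + t          ≡⟨ cong (_+ t) (sym tm≡e) ⟩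
    t * m + t      ≡⟨ solve (t ∷ m ∷ []) ⟩
    t * suc m      ∎)
    where
      open ≡-Reasoning
      tm≡e : t * m ≡ e
      tm≡e = +-cancelˡ-≡ (e * m) _ _ (begin
        e * m + t * m  ≡⟨ solve (e ∷ t ∷ m ∷ []) ⟩
        (e + t) * m    ≡⟨ eq ⟩
        e * suc m      ≡⟨ solve (e ∷ m ∷ []) ⟩
        e * m + e      ∎)

  representation-shift : ∀ {a₁ b₁ a₂ b₂} → a₁ ≤ a₂ → a₁ * suc m + b₁ * m ≡ a₂ * suc m + b₂ * m →
                         ∃ λ t → a₂ ≡ a₁ + t * m × b₁ ≡ b₂ + t * suc m
  representation-shift {a₁} {b₁} {_} {b₂} a₁≤a₂ eq with m≤n⇒∃[o]m+o≡n a₁≤a₂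
  ... | e , refl with m≤n⇒∃[o]m+o≡n b₂≤b₁
    where
      b₂≤b₁ : b₂ ≤ b₁
      b₂≤b₁ = *-cancelʳ-≤ b₂ b₁ m (+-cancelˡ-≤ (a₁ * suc m) _ _ (begin
        a₁ * suc m + b₂ * m              ≤⟨ +-monoʳ-≤ (a₁ * suc m) (m≤n+m (b₂ * m) (e * suc m)) ⟩
        a₁ * suc m + (e * suc m + b₂ * m) ≡⟨ solve (a₁ ∷ e ∷ b₂ ∷ m ∷ []) ⟩
        (a₁ + e) * suc m + b₂ * m        ≡⟨ sym eq ⟩
        a₁ * suc m + b₁ * m              ∎))
        where open ≤-Reasoning
  ... | f , refl = map₂ (map (cong (a₁ +_)) (cong (b₂ +_))) (consecutive-common-multiple e f fm≡e[1+m])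
    where
      open ≡-Reasoning
      fm≡e[1+m] : f * m ≡ e * suc m
      fm≡e[1+m] = +-cancelˡ-≡ (a₁ * suc m + b₂ * m) _ _ (begin
        a₁ * suc m + b₂ * m + f * m      ≡⟨ solve (a₁ ∷ b₂ ∷ f ∷ m ∷ []) ⟩
        a₁ * suc m + (b₂ + f) * m        ≡⟨ eq ⟩
        (a₁ + e) * suc m + b₂ * m        ≡⟨ solve (a₁ ∷ e ∷ b₂ ∷ m ∷ []) ⟩
        a₁ * suc m + b₂ * m + e * suc m  ∎)

  representations : ∀ {a₁ b₁ a₂ b₂} → a₁ * suc m + b₁ * m ≡ a₂ * suc m + b₂ * m → ∃ λ t →
                    (a₂ ≡ a₁ + t * m × b₁ ≡ b₂ + t * suc m) ⊎ (a₁ ≡ a₂ + t * m × b₂ ≡ b₁ + t * suc m)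
  representations {a₁} {b₁} {a₂} {b₂} eq with ≤-total a₁ a₂
  ... | inj₁ a₁≤a₂ = map₂ inj₁ (representation-shift {a₁} {b₁} {a₂} {b₂} a₁≤a₂ eq)
  ... | inj₂ a₂≤a₁ = map₂ inj₂ (representation-shift {a₂} {b₂} {a₁} {b₁} a₂≤a₁ (sym eq))

  representation-surplus : ∀ {a₁ b₁ a₂ b₂} → a₁ * suc m + b₁ * m ≡ a₂ * suc m + b₂ * m →
                           (a₁ ≡ a₂ × b₁ ≡ b₂)
                           ⊎ ∃₂ λ a b → a₁ * suc m + b₁ * m ≡ suc m * m + (a * suc m + b * m)
  representation-surplus {a₁} {b₁} {a₂} {b₂} eq with representations {a₁} {b₁} {a₂} {b₂} eq
  ... | zero , inj₁ (refl , refl) = inj₁ (sym (+-identityʳ a₁) , +-identityʳ b₂)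
  ... | zero , inj₂ (refl , refl) = inj₁ (+-identityʳ a₂ , sym (+-identityʳ b₁))
  ... | suc t , inj₁ (_ , refl) = inj₂ (a₁ , b₂ + t * suc m , solve (a₁ ∷ b₂ ∷ t ∷ m ∷ []))
  ... | suc t , inj₂ (refl , _) = inj₂ (a₂ + t * m , b₁ , solve (a₂ ∷ b₁ ∷ t ∷ m ∷ []))

  no-representation-below : ∀ {d x a b} → d ≤ x → x < m →
                            (suc m + d) * m + x ≢ m + (suc m * m + (a * suc m + b * m))
  no-representation-below {d} {x} {a} {b} d≤x x<m eq = split (a <? m)
    where
      eq′ : d * m + x ≡ suc (a + b) * m + a
      eq′ = +-cancelˡ-≡ (suc m * m) _ _ (begin
        suc m * m + (d * m + x)                   ≡⟨ solve (d ∷ x ∷ m ∷ []) ⟩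
        (suc m + d) * m + x                       ≡⟨ eq ⟩
        m + (suc m * m + (a * suc m + b * m))     ≡⟨ solve (a ∷ b ∷ m ∷ []) ⟩
        suc m * m + (suc (a + b) * m + a)         ∎)
        where open ≡-Reasoning
      split : Dec (a < m) → ⊥
      split (yes a<m) = m+n≮m a b (subst₂ _≤_ (quotient-unique d (suc (a + b)) x<m a<m eq′)
                                              (remainder-unique d (suc (a + b)) x<m a<m eq′) d≤x)
      split (no a≮m) = <-irrefl eq′ (begin-strict
        d * m + x            <⟨ +-monoʳ-< (d * m) x<m ⟩
        d * m + m            ≡⟨ +-comm (d * m) m ⟩
        suc d * m            ≤⟨ *-monoˡ-≤ m (≤-<-trans d≤x x<m) ⟩
        m * m                ≤⟨ *-monoˡ-≤ m (≮⇒≥ a≮m) ⟩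
        a * m                ≤⟨ *-monoˡ-≤ m (≤-trans (m≤m+n a b) (n≤1+n (a + b))) ⟩
        suc (a + b) * m      ≤⟨ m≤m+n _ a ⟩
        suc (a + b) * m + a  ∎)
        where open ≤-Reasoning

  no-representation-stripped : ∀ {d L a b} → d ≤ m → suc L ≡ (suc m + d) * m →
                               L + 0 ≢ m + (suc m * m + (a * suc m + b * m))
  no-representation-stripped {d} {L} {a} {b} d≤m 1+L≡ eq = split (suc a <? m)
    where
      eq′ : d * m + 0 ≡ suc (a + b) * m + suc a
      eq′ = +-cancelˡ-≡ (suc m * m) _ _ (begin
        suc m * m + (d * m + 0)                        ≡⟨ solve (d ∷ m ∷ []) ⟩
        (suc m + d) * m                                ≡⟨ sym 1+L≡ ⟩
        suc L                                          ≡⟨ cong suc (trans (sym (+-identityʳ L)) eq) ⟩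
        suc (m + (suc m * m + (a * suc m + b * m)))    ≡⟨ solve (a ∷ b ∷ m ∷ []) ⟩
        suc m * m + (suc (a + b) * m + suc a)          ∎)
        where open ≡-Reasoning
      split : Dec (suc a < m) → ⊥
      split (yes 1+a<m) = 0≢1+n (remainder-unique d (suc (a + b)) (<-trans z<s 1+a<m) 1+a<m eq′)
      split (no 1+a≮m) = <-irrefl eq′ (begin-strict
        d * m + 0                ≡⟨ +-identityʳ (d * m) ⟩
        d * m                    ≤⟨ *-monoˡ-≤ m d≤m ⟩
        m * m                    ≤⟨ *-monoˡ-≤ m (≮⇒≥ 1+a≮m) ⟩
        suc a * m                ≤⟨ *-monoˡ-≤ m (s≤s (m≤m+n a b)) ⟩
        suc (a + b) * m          <⟨ m<m+n _ z<s ⟩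
        suc (a + b) * m + suc a  ∎)
        where open ≤-Reasoning

  offset-tally : ∀ {x v} δ q → v < suc m → suc x + suc m ≡ v + (δ + q * suc m) →
                 ∃ λ A → δ + q ≡ suc A × (1 ≤ A ⊎ x < m)
  offset-tally {x} {v} δ zero v<n eq with 2≤δ
    where
      2≤δ : 2 ≤ δ
      2≤δ = +-cancelˡ-≤ v 2 δ (begin
        v + 2            ≡⟨ +-comm v 2 ⟩
        suc (suc v)      ≤⟨ s≤s (≤-trans v<n (m≤n+m (suc m) x)) ⟩
        suc x + suc m    ≡⟨ eq ⟩
        v + (δ + 0)      ≡⟨ cong (v +_) (+-identityʳ δ) ⟩
        v + δ            ∎)
        where open ≤-Reasoning
  ... | s≤s (s≤s {n = δ′} _) = suc δ′ , +-identityʳ δ , inj₁ (s≤s z≤n)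
  offset-tally {x} {v} zero (suc zero) v<n eq = 0 , refl , inj₂ (s≤s⁻¹ (subst (_< suc m) (sym 1+x≡v) v<n))
    where
      1+x≡v : suc x ≡ v
      1+x≡v = +-cancelʳ-≡ (suc m) _ _ (trans eq (cong (v +_) (+-identityʳ (suc m))))
  offset-tally (suc δ) (suc zero) v<n eq = suc δ , +-comm (suc δ) 1 , inj₁ (s≤s z≤n)
  offset-tally δ (suc (suc q)) v<n eq =
    δ + suc q , +-suc δ (suc q) , inj₁ (≤-trans (s≤s z≤n) (m≤n+m (suc q) δ))

  upper-length : ∀ {x v} δ q B {A} → suc x + suc m ≡ v + (δ + q * suc m) → δ + q ≡ suc A →
                 suc ((suc m + (δ + B)) * m) + x ≡ v + (A * suc m + (B + suc m) * m)
  upper-length {x} {v} δ q B {A} eq δ+q≡1+A = +-cancelʳ-≡ (suc m) _ _ (begin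
    suc ((suc m + (δ + B)) * m) + x + suc m      ≡⟨ solve (x ∷ δ ∷ B ∷ m ∷ []) ⟩
    (suc x + suc m) + (suc m + (δ + B)) * m      ≡⟨ cong (_+ (suc m + (δ + B)) * m) eq ⟩
    v + (δ + q * suc m) + (suc m + (δ + B)) * m  ≡⟨ solve (v ∷ δ ∷ q ∷ B ∷ m ∷ []) ⟩
    v + ((δ + q) * suc m + (B + suc m) * m)      ≡⟨ cong (λ c → v + (c * suc m + (B + suc m) * m)) δ+q≡1+A ⟩
    v + (suc A * suc m + (B + suc m) * m)        ≡⟨ solve (v ∷ A ∷ B ∷ m ∷ []) ⟩
    v + (A * suc m + (B + suc m) * m) + suc m    ∎)
    where open ≡-Reasoning

  lap-exchange : ∀ a b → (a + m) * suc m + b * m ≡ a * suc m + (b + suc m) * m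
  lap-exchange a b = solve (a ∷ b ∷ m ∷ [])

-- Data.Vec's _∷_ is kept local: beside Data.List's it would make the ring solver's
-- variable lists ambiguous.
module SubsetCounting where

  open import Data.Vec using (_∷_; []; here; there)

  x∉p-x : ∀ {n} (p : Subset n) x → x ∉ p - x
  x∉p-x (_ ∷ p) fzero ()
  x∉p-x (_ ∷ p) (fsuc x) (there x∈p-x) = x∉p-x p x x∈p-x

  suc∣p-x∣≡∣p∣ : ∀ {n} {p : Subset n} {x} → x ∈ p → suc ∣ p - x ∣ ≡ ∣ p ∣
  suc∣p-x∣≡∣p∣ {p = inside ∷ p} here = cong (suc ∘′ ∣_∣) (p─⊥≡p p)
  suc∣p-x∣≡∣p∣ {p = inside ∷ p} (there x∈p) = cong suc (suc∣p-x∣≡∣p∣ x∈p)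
  suc∣p-x∣≡∣p∣ {p = outside ∷ p} (there x∈p) = suc∣p-x∣≡∣p∣ x∈p

  nonempty : ∀ {n} (p : Subset n) → 0 < ∣ p ∣ → Nonempty p
  nonempty (inside ∷ p) _ = fzero , here
  nonempty (outside ∷ p) 0<∣p∣ = Product.map fsuc there (nonempty p 0<∣p∣)

  module _ {n k} {f : Fin n → Fin k} (f-injective : Injective _≡_ _≡_ f) where

    ∣p∣≤∣q∣-injection : ∀ {p q} → (∀ {x} → x ∈ p → f x ∈ q) → ∣ p ∣ ≤ ∣ q ∣
    ∣p∣≤∣q∣-injection = go _ refl
      where
        go : ∀ c {p q} → ∣ p ∣ ≡ c → (∀ {x} → x ∈ p → f x ∈ q) → ∣ p ∣ ≤ ∣ q ∣
        go zero ∣p∣≡0 _ = subst (_≤ _) (sym ∣p∣≡0) z≤n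
        go (suc c) {p} {q} ∣p∣≡1+c into with nonempty p (subst (0 <_) (sym ∣p∣≡1+c) z<s)
        ... | x , x∈p = begin
          ∣ p ∣           ≡⟨ sym (suc∣p-x∣≡∣p∣ x∈p) ⟩
          suc ∣ p - x ∣   ≤⟨ s≤s (go c (suc-injective (trans (suc∣p-x∣≡∣p∣ x∈p) ∣p∣≡1+c)) into′) ⟩
          suc ∣ q - f x ∣ ≡⟨ suc∣p-x∣≡∣p∣ (into x∈p) ⟩
          ∣ q ∣           ∎
          where
            open ≤-Reasoning
            into′ : ∀ {y} → y ∈ p - x → f y ∈ q - f x
            into′ {y} y∈p-x = x∈p∧x≢y⇒x∈p-y (into (p─q⊆p p ⁅ x ⁆ y∈p-x))
              λ fy≡fx → x∉p-x p x (subst (_∈ p - x) (f-injective fy≡fx) y∈p-x)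

  upFrom : ∀ {n} → ℕ → Subset n
  upFrom {zero} d = []
  upFrom {suc n} zero = inside ∷ upFrom zero
  upFrom {suc n} (suc d) = outside ∷ upFrom d

  ∈upFrom⁺ : ∀ {n d} {x : Fin n} → d ≤ toℕ x → x ∈ upFrom d
  ∈upFrom⁺ {d = zero} {fzero} _ = here
  ∈upFrom⁺ {d = zero} {fsuc x} _ = there (∈upFrom⁺ z≤n)
  ∈upFrom⁺ {d = suc d} {fsuc x} (s≤s d≤x) = there (∈upFrom⁺ d≤x)

  ∈upFrom⁻ : ∀ {n d} {x : Fin n} → x ∈ upFrom d → d ≤ toℕ x
  ∈upFrom⁻ {d = zero} _ = z≤n
  ∈upFrom⁻ {d = suc d} {fsuc x} (there x∈) = s≤s (∈upFrom⁻ x∈)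

  ∣upFrom∣ : ∀ n d → ∣ upFrom {n} d ∣ ≡ n ∸ d
  ∣upFrom∣ zero zero = refl
  ∣upFrom∣ zero (suc d) = refl
  ∣upFrom∣ (suc n) zero = cong suc (∣upFrom∣ n zero)
  ∣upFrom∣ (suc n) (suc d) = ∣upFrom∣ n d

  pigeonhole-≤ : ∀ {n} {f : Fin n → Fin n} → Injective _≡_ _≡_ f → ∀ {X : Subset n} {d} →
                 ∣ X ∣ + d ≡ n → 0 < ∣ X ∣ → ∃ λ x → x ∈ X × toℕ (f x) ≤ d
  pigeonhole-≤ {n} {f} f-injective {X} {d} size 0<∣X∣ with any? (λ x → x ∈? X ×-dec toℕ (f x) ≤? d)
  ... | yes found = found
  ... | no none = contradiction ∣X∣≤∣X∣∸1 (<⇒≱ (∸-monoʳ-< {o = 0} (s≤s z≤n) 0<∣X∣))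
    where
      into : ∀ {x} → x ∈ X → f x ∈ upFrom (suc d)
      into {x} x∈X = ∈upFrom⁺ (≰⇒> λ fx≤d → none (x , x∈X , fx≤d))
      ∣X∣≤∣X∣∸1 : ∣ X ∣ ≤ ∣ X ∣ ∸ 1
      ∣X∣≤∣X∣∸1 = begin
        ∣ X ∣                   ≤⟨ ∣p∣≤∣q∣-injection f-injective into ⟩
        ∣ upFrom {n} (suc d) ∣  ≡⟨ ∣upFrom∣ n (suc d) ⟩
        n ∸ suc d               ≡⟨ cong (_∸ suc d) (sym size) ⟩
        ∣ X ∣ + d ∸ suc d       ≡⟨ cong₂ _∸_ (+-comm ∣ X ∣ d) (+-comm 1 d) ⟩
        d + ∣ X ∣ ∸ (d + 1)     ≡⟨ [m+n]∸[m+o]≡n∸o d ∣ X ∣ 1 ⟩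
        ∣ X ∣ ∸ 1               ∎
        where open ≤-Reasoning

open SubsetCounting

open import Defs

_≟ˢ_ : DecidableEquality Sign
pos ≟ˢ pos = yes refl
pos ≟ˢ neg = no λ ()
neg ≟ˢ pos = no λ ()
neg ≟ˢ neg = yes refl

·-assoc : ∀ a b c → (a · b) · c ≡ a · (b · c)
·-assoc pos b c = refl
·-assoc neg pos c = refl
·-assoc neg neg pos = refl
·-assoc neg neg neg = refl

·-comm : ∀ a b → a · b ≡ b · a
·-comm pos pos = refl
·-comm pos neg = refl
·-comm neg pos = refl
·-comm neg neg = refl

·-identityʳ : ∀ a → a · pos ≡ a
·-identityʳ pos = refl
·-identityʳ neg = refl

·-involutive : ∀ a b → a · (a · b) ≡ b
·-involutive pos b = refl
·-involutive neg pos = refl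
·-involutive neg neg = refl

·-cancelˡ : ∀ a {b c} → a · b ≡ a · c → b ≡ c
·-cancelˡ a {b} {c} eq = trans (sym (·-involutive a b)) (trans (cong (a ·_) eq) (·-involutive a c))

·-cancelʳ : ∀ a {b c} → b · a ≡ c · a → b ≡ c
·-cancelʳ a {b} {c} eq = ·-cancelˡ a (trans (·-comm a b) (trans eq (·-comm c a)))

·-commutativeMonoid : CommutativeMonoid 0ℓ 0ℓ
·-commutativeMonoid = record
  { isCommutativeMonoid = record
    { isMonoid = record
      { isSemigroup = record { isMagma = isMagma _·_ ; assoc = ·-assoc }
      ; identity = (λ _ → refl) , ·-identityʳ
      }
    ; comm = ·-comm
    }
  }

open import Algebra.Properties.CommutativeSemigroup
  (CommutativeMonoid.commutativeSemigroup ·-commutativeMonoid) using (interchange)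

infixr 30 _^_

_^_ : Sign → ℕ → Sign
s ^ zero = pos
s ^ suc k = s · s ^ k

^-+ : ∀ s a b → s ^ (a + b) ≡ s ^ a · s ^ b
^-+ s zero b = refl
^-+ s (suc a) b = trans (cong (s ·_) (^-+ s a b)) (sym (·-assoc s _ _))

^-* : ∀ s t k → s ^ (t * k) ≡ (s ^ k) ^ t
^-* s zero k = refl
^-* s (suc t) k = trans (^-+ s k (t * k)) (cong (s ^ k ·_) (^-* s t k))

module _ (σ τ : Sign) where

  ^-·-^-+ : ∀ a₁ b₁ a₂ b₂ → (σ ^ a₁ · τ ^ b₁) · (σ ^ a₂ · τ ^ b₂) ≡ σ ^ (a₁ + a₂) · τ ^ (b₁ + b₂)
  ^-·-^-+ a₁ b₁ a₂ b₂ = begin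
    (σ ^ a₁ · τ ^ b₁) · (σ ^ a₂ · τ ^ b₂) ≡⟨ interchange (σ ^ a₁) (τ ^ b₁) (σ ^ a₂) (τ ^ b₂) ⟩
    (σ ^ a₁ · σ ^ a₂) · (τ ^ b₁ · τ ^ b₂) ≡⟨ sym (cong₂ _·_ (^-+ σ a₁ a₂) (^-+ τ b₁ b₂)) ⟩
    σ ^ (a₁ + a₂) · τ ^ (b₁ + b₂)         ∎
    where open ≡-Reasoning

  ^-shift : ∀ {k l} a b t → σ ^ k ≡ τ ^ l → σ ^ (a + t * k) · τ ^ b ≡ σ ^ a · τ ^ (b + t * l)
  ^-shift {k} {l} a b t σᵏ≡τˡ = begin
    σ ^ (a + t * k) · τ ^ b         ≡⟨ cong (_· τ ^ b) (^-+ σ a (t * k)) ⟩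
    (σ ^ a · σ ^ (t * k)) · τ ^ b   ≡⟨ ·-assoc (σ ^ a) _ _ ⟩
    σ ^ a · (σ ^ (t * k) · τ ^ b)   ≡⟨ cong (λ s → σ ^ a · (s · τ ^ b)) σᵗᵏ≡τᵗˡ ⟩
    σ ^ a · (τ ^ (t * l) · τ ^ b)   ≡⟨ cong (σ ^ a ·_) (·-comm (τ ^ (t * l)) (τ ^ b)) ⟩
    σ ^ a · (τ ^ b · τ ^ (t * l))   ≡⟨ cong (σ ^ a ·_) (sym (^-+ τ b (t * l))) ⟩
    σ ^ a · τ ^ (b + t * l)         ∎
    where
      open ≡-Reasoning
      σᵗᵏ≡τᵗˡ : σ ^ (t * k) ≡ τ ^ (t * l)
      σᵗᵏ≡τᵗˡ = trans (^-* σ t k) (trans (cong (_^ t) σᵏ≡τˡ) (sym (^-* τ t l)))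

  ^-shift-cancel : ∀ {k l} a b → σ ^ (a + k) · τ ^ b ≡ σ ^ a · τ ^ (b + l) → σ ^ k ≡ τ ^ l
  ^-shift-cancel {k} {l} a b eq = ·-cancelʳ (τ ^ b) (·-cancelˡ (σ ^ a) (begin
    σ ^ a · (σ ^ k · τ ^ b)   ≡⟨ sym (·-assoc (σ ^ a) _ _) ⟩
    (σ ^ a · σ ^ k) · τ ^ b   ≡⟨ cong (_· τ ^ b) (sym (^-+ σ a k)) ⟩
    σ ^ (a + k) · τ ^ b       ≡⟨ eq ⟩
    σ ^ a · τ ^ (b + l)       ≡⟨ cong (σ ^ a ·_) (trans (^-+ τ b l) (·-comm (τ ^ b) (τ ^ l))) ⟩
    σ ^ a · (τ ^ l · τ ^ b)   ∎))
    where open ≡-Reasoning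

prefixProduct : ∀ {k} → (Fin k → Sign) → Fin (suc k) → Sign
prefixProduct τ fzero = pos
prefixProduct {suc k} τ (fsuc i) = τ fzero · prefixProduct (τ ∘ fsuc) i

prefixProduct-suc : ∀ {k} (τ : Fin k → Sign) i →
                    prefixProduct τ (fsuc i) ≡ prefixProduct τ (inject₁ i) · τ i
prefixProduct-suc {suc k} τ fzero = ·-identityʳ (τ fzero)
prefixProduct-suc {suc k} τ (fsuc i) =
  trans (cong (τ fzero ·_) (prefixProduct-suc (τ ∘ fsuc) i)) (sym (·-assoc (τ fzero) _ _))

infixr 5 _++ʷ_

_++ʷ_ : ∀ {n} {D : Digraph n} {a b x y z} → Walk D a x y → Walk D b y z → Walk D (a + b) x z
[] ++ʷ w = w
(e ∷ w₁) ++ʷ w₂ = e ∷ (w₁ ++ʷ w₂)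

_∷ʳ_ : ∀ {n} {D : Digraph n} {a x y z} → Walk D a x y → D y z → Walk D (suc a) x z
[] ∷ʳ e = e ∷ []
(e′ ∷ w) ∷ʳ e = e′ ∷ (w ∷ʳ e)

module SignedWalks {n : ℕ} (S : SignedDigraph n) where

  arc-sign-unique : ∀ {u y} (e e′ : Underlying S u y) → proj₁ e ≡ proj₁ e′
  arc-sign-unique (_ , e) (_ , e′) = just-injective (trans (sym e) e′)

  sign-++ : ∀ {a b x y z} (w₁ : SWalk S a x y) (w₂ : SWalk S b y z) →
            sign (w₁ ++ʷ w₂) ≡ sign w₁ · sign w₂
  sign-++ [] w₂ = refl
  sign-++ ((s , _) ∷ w₁) w₂ = trans (cong (s ·_) (sign-++ w₁ w₂)) (sym (·-assoc s _ _))

  sign-∷ʳ : ∀ {a x y z} (w : SWalk S a x y) (e : Underlying S y z) → sign (w ∷ʳ e) ≡ sign w · proj₁ e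
  sign-∷ʳ [] (s , _) = ·-identityʳ s
  sign-∷ʳ ((t , _) ∷ w) e = trans (cong (t ·_) (sign-∷ʳ w e)) (sym (·-assoc t _ _))

  WalkOfSign : ℕ → Fin n → Fin n → Sign → Set
  WalkOfSign q x v s = Σ (SWalk S q x v) λ w → sign w ≡ s

  walkOfSign? : ∀ q x v s → Dec (WalkOfSign q x v s)
  walkOfSign? zero x v s = map′ (λ { (refl , refl) → [] , refl }) (λ { ([] , refl) → refl , refl })
                                (x ≟ v ×-dec pos ≟ˢ s)
  walkOfSign? (suc q) x v s = map′ extend split (any? firstArc?)
    where
      FirstArc : Fin n → Set
      FirstArc y = Σ (Underlying S x y) λ e → WalkOfSign q y v (proj₁ e · s)

      firstArc? : ∀ y → Dec (FirstArc y)
      firstArc? y with S x y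
      ... | nothing = no λ { ((_ , ()) , _) }
      ... | just t = map′ ((t , refl) ,_) (λ { ((_ , refl) , w) → w }) (walkOfSign? q y v (t · s))

      extend : ∃ FirstArc → WalkOfSign (suc q) x v s
      extend (_ , e , w , eq) = e ∷ w , trans (cong (proj₁ e ·_) eq) (·-involutive (proj₁ e) s)

      split : WalkOfSign (suc q) x v s → ∃ FirstArc
      split (e ∷ w , eq) = _ , e , w , trans (sym (·-involutive (proj₁ e) (sign w))) (cong (proj₁ e ·_) eq)

  SSSD⇒both-signs : ∀ {q x v} → SSSD S q x v → WalkOfSign q x v pos × WalkOfSign q x v neg
  SSSD⇒both-signs (w₁ , w₂ , s₁≢s₂) with sign w₁ in e₁ | sign w₂ in e₂
  ... | pos | pos = contradiction refl s₁≢s₂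
  ... | pos | neg = (w₁ , e₁) , (w₂ , e₂)
  ... | neg | pos = (w₂ , e₂) , (w₁ , e₁)
  ... | neg | neg = contradiction refl s₁≢s₂

  both-signs⇒SSSD : ∀ {q x v} → WalkOfSign q x v pos × WalkOfSign q x v neg → SSSD S q x v
  both-signs⇒SSSD ((w₁ , e₁) , (w₂ , e₂)) =
    w₁ , w₂ , λ eq → case trans (sym e₁) (trans eq e₂) of λ ()

  SSSD? : ∀ q x v → Dec (SSSD S q x v)
  SSSD? q x v = map′ both-signs⇒SSSD SSSD⇒both-signs (walkOfSign? q x v pos ×-dec walkOfSign? q x v neg)

  SSSDBase? : ∀ X → Decidable (SSSDBase S X)
  SSSDBase? X q = all? λ v → any? λ x → x ∈? X ×-dec SSSD? q x v

  SSSD-∷ʳ : ∀ {q x u v} → SSSD S q x u → Underlying S u v → SSSD S (suc q) x v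
  SSSD-∷ʳ (w₁ , w₂ , s₁≢s₂) e = w₁ ∷ʳ e , w₂ ∷ʳ e , λ eq →
    s₁≢s₂ (·-cancelʳ (proj₁ e) (trans (sym (sign-∷ʳ w₁ e)) (trans eq (sign-∷ʳ w₂ e))))

  SSSD-uncons : ∀ {q u w v} → (∀ {y} → Underlying S u y → y ≡ w) → SSSD S (suc q) u v → SSSD S q w v
  SSSD-uncons only (e₁ ∷ w₁ , e₂ ∷ w₂ , s₁≢s₂) with only e₁ | only e₂
  ... | refl | refl = w₁ , w₂ , λ eq → s₁≢s₂ (cong₂ _·_ (arc-sign-unique e₁ e₂) eq)

  module _ (in-arc : ∀ v → ∃ λ u → Underlying S u v) {X : Subset n} where

    SSSDBase-suc : ∀ {q} → SSSDBase S X q → SSSDBase S X (suc q)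
    SSSDBase-suc base v =
      let u , e = in-arc v ; x , x∈X , sssd = base u in x , x∈X , SSSD-∷ʳ sssd e

    SSSDBase-mono : ∀ {q r} → q ≤ r → SSSDBase S X q → SSSDBase S X r
    SSSDBase-mono q≤r = go (≤⇒≤′ q≤r)
      where
        go : ∀ {q r} → q ≤′ r → SSSDBase S X q → SSSDBase S X r
        go ≤′-refl base = base
        go (≤′-step q≤′r) base = SSSDBase-suc (go q≤′r base)

module D₁-Signing (m′ : ℕ) (S : SignedDigraph (suc (suc m′)))
                  (S≈D₁ : SameDigraph (Underlying S) (D₁ (suc (suc m′)))) where

  open SignedWalks S
  open Representations (suc m′)

  m n : ℕ
  m = suc m′
  n = suc m

  last penult : Fin n
  last = fromℕ m
  penult = inject₁ (fromℕ m′)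

  toℕ-last : toℕ last ≡ m
  toℕ-last = toℕ-fromℕ m

  toℕ-last-+ : ∀ r → toℕ last + r ≡ m + r
  toℕ-last-+ r = cong (_+ r) toℕ-last

  toℕ-penult : toℕ penult ≡ m′
  toℕ-penult = trans (toℕ-inject₁ (fromℕ m′)) (toℕ-fromℕ m′)

  data Arc : Fin n → Fin n → Set where
    step  : (i : Fin m) → Arc (inject₁ i) (fsuc i)
    close : Arc last fzero
    chord : Arc penult fzero

  D₁⇒Arc : ∀ {u y} → D₁ n u y → Arc u y
  D₁⇒Arc {y = fzero} (inj₁ ())
  D₁⇒Arc {u} {fsuc i} (inj₁ 1+i≡1+u)
    with toℕ-injective {i = u} {j = inject₁ i} (trans (sym (suc-injective 1+i≡1+u)) (sym (toℕ-inject₁ i)))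
  ... | refl = step i
  D₁⇒Arc {y = fsuc _} (inj₂ (() , _))
  D₁⇒Arc {u} {fzero} (inj₂ (_ , inj₁ 1+u≡n))
    with toℕ-injective {i = u} {j = last} (trans (suc-injective 1+u≡n) (sym toℕ-last))
  ... | refl = close
  D₁⇒Arc {u} {fzero} (inj₂ (_ , inj₂ 2+u≡n))
    with toℕ-injective {i = u} {j = penult} (trans (suc-injective (suc-injective 2+u≡n)) (sym toℕ-penult))
  ... | refl = chord

  Arc⇒D₁ : ∀ {u y} → Arc u y → D₁ n u y
  Arc⇒D₁ (step i) = inj₁ (cong suc (sym (toℕ-inject₁ i)))
  Arc⇒D₁ close = inj₂ (refl , inj₁ (cong suc toℕ-last))
  Arc⇒D₁ chord = inj₂ (refl , inj₂ (cong (suc ∘ suc) toℕ-penult))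

  arc-view : ∀ {u y} → Underlying S u y → Arc u y
  arc-view {u} {y} e = D₁⇒Arc (proj₁ (S≈D₁ u y) e)

  edge : ∀ {u y} → Arc u y → Underlying S u y
  edge {u} {y} a = proj₂ (S≈D₁ u y) (Arc⇒D₁ a)

  arc-sign : ∀ {u y} → Arc u y → Sign
  arc-sign a = proj₁ (edge a)

  n-laps m-laps : ∀ {u y} → Arc u y → ℕ
  n-laps close = 1
  n-laps _ = 0
  m-laps chord = 1
  m-laps _ = 0

  in-arc : ∀ v → ∃ λ u → Underlying S u v
  in-arc fzero = last , edge close
  in-arc (fsuc i) = inject₁ i , edge (step i)

  leaves-last : ∀ {y} → Underlying S last y → y ≡ fzero
  leaves-last e = from-last (arc-view e) toℕ-last
    where
      from-last : ∀ {u y} → Arc u y → toℕ u ≡ m → y ≡ fzero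
      from-last (step i) eq = contradiction (trans (sym (toℕ-inject₁ i)) eq) (<⇒≢ (toℕ<n i))
      from-last close _ = refl
      from-last chord eq = contradiction (trans (sym toℕ-penult) eq) (≢-sym 1+n≢n)

  -- A switching potential that makes every step arc positive.
  π : Fin n → Sign
  π = prefixProduct (arc-sign ∘ step)

  α β : Sign
  α = π last · arc-sign close
  β = π penult · arc-sign chord

  W : ℕ → ℕ → Sign
  W a b = α ^ a · β ^ b

  record Winds {L x v} (a b : ℕ) (w : SWalk S L x v) : Set where
    constructor winding
    field
      length    : L + toℕ x ≡ toℕ v + (a * n + b * m)
      potential : π x · sign w ≡ W a b · π v
  open Winds

  winds-[] : ∀ {x} → Winds 0 0 ([] {u = x})
  winds-[] {x} = winding (sym (+-identityʳ (toℕ x))) (·-identityʳ (π x))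

  winds-++ : ∀ {L₁ L₂ x y v a₁ b₁ a₂ b₂} {w₁ : SWalk S L₁ x y} {w₂ : SWalk S L₂ y v} →
             Winds a₁ b₁ w₁ → Winds a₂ b₂ w₂ → Winds (a₁ + a₂) (b₁ + b₂) (w₁ ++ʷ w₂)
  winds-++ {L₁} {L₂} {x} {y} {v} {a₁} {b₁} {a₂} {b₂} {w₁} {w₂} (winding ℓ₁ s₁) (winding ℓ₂ s₂) =
    winding length₁₂ potential₁₂
    where
      open ≡-Reasoning
      length₁₂ : (L₁ + L₂) + toℕ x ≡ toℕ v + ((a₁ + a₂) * n + (b₁ + b₂) * m)
      length₁₂ = begin
        (L₁ + L₂) + toℕ x                           ≡⟨ cong (_+ toℕ x) (+-comm L₁ L₂) ⟩
        (L₂ + L₁) + toℕ x                           ≡⟨ +-assoc L₂ L₁ (toℕ x) ⟩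
        L₂ + (L₁ + toℕ x)                           ≡⟨ cong (L₂ +_) ℓ₁ ⟩
        L₂ + (toℕ y + (a₁ * n + b₁ * m))            ≡⟨ sym (+-assoc L₂ (toℕ y) _) ⟩
        (L₂ + toℕ y) + (a₁ * n + b₁ * m)            ≡⟨ cong (_+ (a₁ * n + b₁ * m)) ℓ₂ ⟩
        toℕ v + (a₂ * n + b₂ * m) + (a₁ * n + b₁ * m) ≡⟨ +-assoc (toℕ v) _ _ ⟩
        toℕ v + ((a₂ * n + b₂ * m) + (a₁ * n + b₁ * m)) ≡⟨ cong (toℕ v +_) (+-comm (a₂ * n + b₂ * m) _) ⟩
        toℕ v + ((a₁ * n + b₁ * m) + (a₂ * n + b₂ * m)) ≡⟨ cong (toℕ v +_) (laps-+ n m a₁ b₁ a₂ b₂) ⟩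
        toℕ v + ((a₁ + a₂) * n + (b₁ + b₂) * m)     ∎
      potential₁₂ : π x · sign (w₁ ++ʷ w₂) ≡ W (a₁ + a₂) (b₁ + b₂) · π v
      potential₁₂ = begin
        π x · sign (w₁ ++ʷ w₂)        ≡⟨ cong (π x ·_) (sign-++ w₁ w₂) ⟩
        π x · (sign w₁ · sign w₂)     ≡⟨ sym (·-assoc (π x) _ _) ⟩
        (π x · sign w₁) · sign w₂     ≡⟨ cong (_· sign w₂) s₁ ⟩
        (W a₁ b₁ · π y) · sign w₂     ≡⟨ ·-assoc (W a₁ b₁) _ _ ⟩
        W a₁ b₁ · (π y · sign w₂)     ≡⟨ cong (W a₁ b₁ ·_) s₂ ⟩
        W a₁ b₁ · (W a₂ b₂ · π v)     ≡⟨ sym (·-assoc (W a₁ b₁) _ _) ⟩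
        (W a₁ b₁ · W a₂ b₂) · π v     ≡⟨ cong (_· π v) (^-·-^-+ α β a₁ b₁ a₂ b₂) ⟩
        W (a₁ + a₂) (b₁ + b₂) · π v   ∎

  winds-arc : ∀ {u y} (a : Arc u y) (e : Underlying S u y) → Winds (n-laps a) (m-laps a) (e ∷ [])
  winds-arc {u} {y} a e = winding (arc-length a) (begin
    π u · (proj₁ e · pos)   ≡⟨ cong (π u ·_) (·-identityʳ (proj₁ e)) ⟩
    π u · proj₁ e           ≡⟨ cong (π u ·_) (arc-sign-unique e (edge a)) ⟩
    π u · arc-sign a        ≡⟨ arc-potential a ⟩
    W (n-laps a) (m-laps a) · π y ∎)
    where
      open ≡-Reasoning
      arc-length : ∀ {u y} (a : Arc u y) → suc (toℕ u) ≡ toℕ y + (n-laps a * n + m-laps a * m)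
      arc-length (step i) = trans (cong suc (toℕ-inject₁ i)) (sym (+-identityʳ _))
      arc-length close = trans (cong suc toℕ-last) (sym (trans (+-identityʳ _) (+-identityʳ n)))
      arc-length chord = trans (cong suc toℕ-penult) (sym (+-identityʳ m))
      arc-potential : ∀ {u y} (a : Arc u y) → π u · arc-sign a ≡ W (n-laps a) (m-laps a) · π y
      arc-potential (step i) = sym (prefixProduct-suc (arc-sign ∘ step) i)
      arc-potential close = sym (trans (·-identityʳ _) (trans (·-identityʳ _) (·-identityʳ α)))
      arc-potential chord = sym (trans (·-identityʳ _) (·-identityʳ β))

  walk-winds : ∀ {L x v} (w : SWalk S L x v) → ∃₂ λ a b → Winds a b w
  walk-winds [] = 0 , 0 , winds-[]
  walk-winds (e ∷ w) = let _ , _ , h = walk-winds w in _ , _ , winds-++ (winds-arc (arc-view e) e) h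

  module _ {L₁ L₂ x v a₁ b₁ a₂ b₂} {w₁ : SWalk S L₁ x v} {w₂ : SWalk S L₂ x v}
           (h₁ : Winds a₁ b₁ w₁) (h₂ : Winds a₂ b₂ w₂) where

    W-≡⇒sign-≡ : W a₁ b₁ ≡ W a₂ b₂ → sign w₁ ≡ sign w₂
    W-≡⇒sign-≡ eq =
      ·-cancelˡ (π x) (trans (potential h₁) (trans (cong (_· π v) eq) (sym (potential h₂))))

    sign-≡⇒W-≡ : sign w₁ ≡ sign w₂ → W a₁ b₁ ≡ W a₂ b₂
    sign-≡⇒W-≡ eq =
      ·-cancelʳ (π v) (trans (sym (potential h₁)) (trans (cong (π x ·_) eq) (potential h₂)))

    same-length⇒same-value : L₁ ≡ L₂ → a₁ * n + b₁ * m ≡ a₂ * n + b₂ * m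
    same-length⇒same-value refl = +-cancelˡ-≡ (toℕ v) _ _ (trans (sym (length h₁)) (length h₂))

  nonpowerful⇒α^m≢β^n : NonPowerful S → α ^ m ≢ β ^ n
  nonpowerful⇒α^m≢β^n (_ , _ , _ , w₁ , w₂ , s₁≢s₂) αᵐ≡βⁿ with walk-winds w₁ | walk-winds w₂
  ... | a₁ , b₁ , h₁ | a₂ , b₂ , h₂
      with representations {a₁} {b₁} {a₂} {b₂} (same-length⇒same-value h₁ h₂ refl)
  ... | t , inj₁ (refl , refl) = s₁≢s₂ (W-≡⇒sign-≡ h₁ h₂ (sym (^-shift α β a₁ b₂ t αᵐ≡βⁿ)))
  ... | t , inj₂ (refl , refl) = s₁≢s₂ (W-≡⇒sign-≡ h₁ h₂ (^-shift α β a₂ b₁ t αᵐ≡βⁿ))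

  SSSD⇒surplus : ∀ {L x v} → SSSD S L x v → ∃₂ λ a b → L + toℕ x ≡ toℕ v + (n * m + (a * n + b * m))
  SSSD⇒surplus {v = v} (w₁ , w₂ , s₁≢s₂) with walk-winds w₁ | walk-winds w₂
  ... | a₁ , b₁ , h₁ | a₂ , b₂ , h₂
      with representation-surplus {a₁} {b₁} {a₂} {b₂} (same-length⇒same-value h₁ h₂ refl)
  ... | inj₁ (refl , refl) = contradiction (W-≡⇒sign-≡ h₁ h₂ refl) s₁≢s₂
  ... | inj₂ (a , b , eq) = a , b , trans (length h₁) (cong (toℕ v +_) eq)

  WindingWalk : Fin n → Fin n → ℕ → ℕ → Set
  WindingWalk x v a b = ∃ λ L → Σ (SWalk S L x v) (Winds a b)

  infixr 5 _⨾_

  _⨾_ : ∀ {x y v a₁ b₁ a₂ b₂} → WindingWalk x y a₁ b₁ → WindingWalk y v a₂ b₂ →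
        WindingWalk x v (a₁ + a₂) (b₁ + b₂)
  (_ , w₁ , h₁) ⨾ (_ , w₂ , h₂) = _ , w₁ ++ʷ w₂ , winds-++ h₁ h₂

  arc-walk : ∀ {u y} (a : Arc u y) → WindingWalk u y (n-laps a) (m-laps a)
  arc-walk a = 1 , edge a ∷ [] , winds-arc a (edge a)

  path : ∀ l {x y} → toℕ x + l ≡ toℕ y → WindingWalk x y 0 0
  path zero {x} {y} x+0≡y with toℕ-injective {i = x} {j = y} (trans (sym (+-identityʳ (toℕ x))) x+0≡y)
  ... | refl = 0 , [] , winds-[]
  path (suc l) {x} {fzero} x+1+l≡0 = contradiction x+1+l≡0 (m+1+n≢0 (toℕ x))
  path (suc l) {x} {fsuc i} x+1+l≡1+i = path l x+l≡i ⨾ arc-walk (step i)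
    where
      x+l≡i : toℕ x + l ≡ toℕ (inject₁ i)
      x+l≡i = trans (suc-injective (trans (sym (+-suc (toℕ x) l)) x+1+l≡1+i)) (sym (toℕ-inject₁ i))

  path-to : ∀ {x y} → toℕ x ≤ toℕ y → WindingWalk x y 0 0
  path-to x≤y = let l , x+l≡y = m≤n⇒∃[o]m+o≡n x≤y in path l x+l≡y

  via-close : ∀ {x} → WindingWalk x fzero 1 0
  via-close {x} = path-to (≤-trans (s≤s⁻¹ (toℕ<n x)) (≤-reflexive (sym toℕ-last))) ⨾ arc-walk close

  via-chord : ∀ {x} → toℕ x < m → WindingWalk x fzero 0 1
  via-chord x<m = path-to (≤-trans (s≤s⁻¹ x<m) (≤-reflexive (sym toℕ-penult))) ⨾ arc-walk chord

  from-zero : ∀ a b {v} → WindingWalk fzero v a b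
  from-zero zero zero = path-to z≤n
  from-zero (suc a) b = via-close ⨾ from-zero a b
  from-zero zero (suc b) = via-chord z<s ⨾ from-zero zero b

  winding-walk : ∀ {x v a b} → 1 ≤ a ⊎ (toℕ x < m × 1 ≤ b) → WindingWalk x v a b
  winding-walk {a = suc a} {b} _ = via-close ⨾ from-zero a b
  winding-walk {a = zero} {suc b} (inj₂ (x<m , _)) = via-chord x<m ⨾ from-zero zero b

  walk-of-length : ∀ {x v a b} N → N + toℕ x ≡ toℕ v + (a * n + b * m) →
                   1 ≤ a ⊎ (toℕ x < m × 1 ≤ b) → Σ (SWalk S N x v) (Winds a b)
  walk-of-length N N+x≡ feasible with winding-walk feasible
  ... | L , w , h with +-cancelʳ-≡ _ L N (trans (length h) (sym N+x≡))
  ... | refl = w , h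

  SSSD-two-windings : ∀ {N x v a b} → α ^ m ≢ β ^ n → N + toℕ x ≡ toℕ v + (a * n + (b + n) * m) →
                      1 ≤ a ⊎ toℕ x < m → SSSD S N x v
  SSSD-two-windings {N} {x} {v} {a} {b} αᵐ≢βⁿ N+x≡ feasible =
    let w₁ , h₁ = walk-of-length {a = a + m} {b} N (trans N+x≡ (cong (toℕ v +_) (sym (lap-exchange a b))))
                                 (inj₁ (≤-trans (s≤s z≤n) (m≤n+m m a)))
        w₂ , h₂ = walk-of-length {a = a} {b + n} N N+x≡
                                 (Sum.map₂ (_, ≤-trans (s≤s z≤n) (m≤n+m n b)) feasible)
    in w₁ , w₂ , λ s₁≡s₂ → αᵐ≢βⁿ (^-shift-cancel α β a b (sign-≡⇒W-≡ h₁ h₂ s₁≡s₂))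

  -- x + 1 − v (mod n), with n added before subtracting to avoid truncation.
  offset : Fin n → Fin n → Fin n
  offset v x = (toℕ x + suc (n ∸ toℕ v)) mod n

  toℕ-offset : ∀ v x → toℕ (offset v x) ≡ (toℕ x + suc (n ∸ toℕ v)) % n
  toℕ-offset v x = toℕ-fromℕ< _

  offset-injective : ∀ v → Injective _≡_ _≡_ (offset v)
  offset-injective v {x} {y} eq = toℕ-injective (+-%-injective (toℕ<n x) (toℕ<n y)
    (trans (sym (toℕ-offset v x)) (trans (cong toℕ eq) (toℕ-offset v y))))

  SSSD-small-offset : α ^ m ≢ β ^ n → ∀ {d x v} → toℕ (offset v x) ≤ d → SSSD S (suc ((n + d) * m)) x v
  SSSD-small-offset αᵐ≢βⁿ {d} {x} {v} δ≤d =
    let q , eq = offset-decomposition {x = toℕ x} (<⇒≤ (toℕ<n v))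
        eq′ = trans eq (cong (λ δ → toℕ v + (δ + q * n)) (sym (toℕ-offset v x)))
        A , δ+q≡1+A , feasible = offset-tally δ q (toℕ<n v) eq′
        B , δ+B≡d = m≤n⇒∃[o]m+o≡n δ≤d
    in subst (λ d → SSSD S (suc ((n + d) * m)) x v) δ+B≡d
             (SSSD-two-windings {b = B} αᵐ≢βⁿ
                (upper-length {toℕ x} {toℕ v} δ q B eq′ δ+q≡1+A) feasible)
    where δ = toℕ (offset v x)

  SSSDBase-upper : α ^ m ≢ β ^ n → ∀ {X d} → ∣ X ∣ + d ≡ n → 0 < ∣ X ∣ → SSSDBase S X (suc ((n + d) * m))
  SSSDBase-upper αᵐ≢βⁿ size 0<∣X∣ v =
    let x , x∈X , near = pigeonhole-≤ (offset-injective v) size 0<∣X∣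
    in x , x∈X , SSSD-small-offset αᵐ≢βⁿ near

  ¬SSSDBase-upFrom : ∀ {d} → d ≤ m → ¬ SSSDBase S (upFrom d) ((n + d) * m)
  ¬SSSDBase-upFrom {d} d≤m base with base last
  ... | x , x∈X , sssd with toℕ x <? m
  ...   | yes x<m = let a , b , eq = SSSD⇒surplus sssd in
                    no-representation-below {a = a} {b} (∈upFrom⁻ x∈X) x<m (trans eq (toℕ-last-+ _))
  -- The only arc out of last enters 0, so SSSD walks from last extend SSSD walks from 0.
  ...   | no x≮m
        with toℕ-injective {i = x} {j = last} (trans (≤-antisym (s≤s⁻¹ (toℕ<n x)) (≮⇒≥ x≮m)) (sym toℕ-last))
  ...     | refl = let a , b , eq = SSSD⇒surplus (SSSD-uncons leaves-last sssd) in
                   no-representation-stripped {a = a} {b} d≤m refl (trans eq (toℕ-last-+ _))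

  upper-base : α ^ m ≢ β ^ n → ∀ {k d} → 0 < k → k + d ≡ n → IsUpperBase S k (suc ((n + d) * m))
  upper-base αᵐ≢βⁿ {k} {d} 0<k k+d≡n =
      (λ X ∣X∣≡k → find-least (SSSDBase? X) (base X ∣X∣≡k))
    , upFrom d , ∣upFrom∣≡k , base (upFrom d) ∣upFrom∣≡k
    , λ q q<N base-q → ¬SSSDBase-upFrom d≤m (SSSDBase-mono in-arc (s≤s⁻¹ q<N) base-q)
    where
      base : ∀ X → ∣ X ∣ ≡ k → SSSDBase S X (suc ((n + d) * m))
      base X ∣X∣≡k =
        SSSDBase-upper αᵐ≢βⁿ (trans (cong (_+ d) ∣X∣≡k) k+d≡n) (subst (0 <_) (sym ∣X∣≡k) 0<k)

      ∣upFrom∣≡k : ∣ upFrom {n} d ∣ ≡ k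
      ∣upFrom∣≡k = trans (∣upFrom∣ n d) (trans (cong (_∸ d) (sym k+d≡n)) (m+n∸n≡m k d))

      d≤m : d ≤ m
      d≤m = s≤s⁻¹ (subst (suc d ≤_) k+d≡n (+-monoˡ-≤ d 0<k))

theorem3p4 : (n : ℕ) → 2 ≤ n → (S₁ : SignedDigraph n)
    → SameDigraph (Underlying S₁) (D₁ n)
    → PrimitiveS S₁ → NonPowerful S₁
    → (k : ℕ) → 1 ≤ k → k ≤ n
    → IsUpperBase S₁ k (((2 * n) ∸ k) * (n ∸ 1) + 1)
-- D₁ is primitive.
theorem3p4 (suc (suc m′)) _ S₁ S₁≈D₁ _ nonpowerful k 1≤k k≤n =
  subst (IsUpperBase S₁ k) (sym length≡)
        (upper-base (nonpowerful⇒α^m≢β^n nonpowerful) 1≤k (m+[n∸m]≡n k≤n))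
  where
    open D₁-Signing m′ S₁ S₁≈D₁
    open ≡-Reasoning
    length≡ : (2 * n ∸ k) * m + 1 ≡ suc ((n + (n ∸ k)) * m)
    length≡ = begin
      (2 * n ∸ k) * m + 1       ≡⟨ +-comm _ 1 ⟩
      suc ((2 * n ∸ k) * m)     ≡⟨ cong (λ c → suc ((n + c ∸ k) * m)) (+-identityʳ n) ⟩
      suc ((n + n ∸ k) * m)     ≡⟨ cong (λ c → suc (c * m)) (+-∸-assoc n k≤n) ⟩
      suc ((n + (n ∸ k)) * m)   ∎
theorem3p4 (suc zero) (s≤s ()) _ _ _ _ _ _ _
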